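{- Let $u\in\Sigma_3^*$, $w\in\Sigma_2^*$, and let $g:\Sigma_3^*\to\Sigma_2^*$ be a non-erasing morphism (i.e., $g(a)$ is nonempty for each letter $a$). If $g(u)=w$ and $w$ avoids $(5/2)^+$-powers, then $u$ has no factor of the form $xyxyx$ with $x,y\in\Sigma_3^*$ and $\pi(x)>\pi(y)$.
   Context: $\Sigma_2=\{0,1\}$, $\Sigma_3=\{0,1,2\}$. For a finite word of length $\ell$ with smallest period $p$, its exponent is $\ell/p$; a $(5/2)^+$-power is a word of exponent $>5/2$; a word avoids $(5/2)^+$-powers if none of its factors is a $(5/2)^+$-power. The Parikh vector of $u\in\Sigma_3^*$ is $\pi(u)=[|u|_0,|u|_1,|u|_2]$ ($|u|_i$ = number of occurrences of letter $i$). $\pi(x)>\pi(y)$ means $|x|_i\ge|y|_i$ for all $i\in\Sigma_3$ and $|x|_i>|y|_i$ for at least one $i$. -}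

module Defs where

open import Data.Nat using (ℕ; zero; suc; _+_; _*_; _≤_; _<_)
open import Data.Fin using (Fin)
open import Data.Fin.Properties using (_≟_)
open import Data.List using (List; []; _∷_; _++_; length; concatMap; filter; lookup)
open import Data.Product using (Σ; ∃; ∃-syntax; _×_; _,_)
open import Data.Sum using (_⊎_)
open import Relation.Binary.PropositionalEquality using (_≡_; _≢_)
open import Relation.Nullary using (¬_)

Σ₂ : Set
Σ₂ = Fin 2

Σ₃ : Set
Σ₃ = Fin 3

Factor : {A : Set} → List A → List A → Set
Factor {A} f w = ∃[ a ] ∃[ b ] (w ≡ a ++ f ++ b)

IsPeriod : {A : Set} → List A → ℕ → Set
IsPeriod w p = 1 ≤ p × p ≤ length w ×
  ((i : ℕ) (h₁ : i < length w) (h₂ : i + p < length w) →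
     lookup w (Data.Fin.fromℕ< h₁) ≡ lookup w (Data.Fin.fromℕ< h₂))

IsSmallestPeriod : {A : Set} → List A → ℕ → Set
IsSmallestPeriod w p = IsPeriod w p × ((q : ℕ) → IsPeriod w q → p ≤ q)

-- w is a (5/2)^+-power: nonempty, with smallest period p and exponent |w|/p > 5/2,
-- i.e. 5 * p < 2 * |w|
IsPower52+ : {A : Set} → List A → Set
IsPower52+ w = ∃[ p ] (IsSmallestPeriod w p × 5 * p < 2 * length w)

Avoids52+ : {A : Set} → List A → Set
Avoids52+ w = (f : List _) → Factor f w → ¬ IsPower52+ f

applyMorph : (Σ₃ → List Σ₂) → List Σ₃ → List Σ₂
applyMorph g u = concatMap g u

NonErasing : (Σ₃ → List Σ₂) → Set
NonErasing g = (a : Σ₃) → g a ≢ []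

count : Σ₃ → List Σ₃ → ℕ
count a u = length (filter (_≟ a) u)

ParikhGt : List Σ₃ → List Σ₃ → Set
ParikhGt x y = ((a : Σ₃) → count a y ≤ count a x) × ∃[ a ] (count a y < count a x)

{-# OPTIONS --safe #-}
-- Non-erasure and π(x) > π(y) give |g(x)| > |g(y)|.  The factor g(x)g(y)g(x)g(y)g(x) of w
-- has period |g(x)g(y)| and length 3|g(x)| + 2|g(y)| > (5/2)|g(x)g(y)|, so its smallest
-- period exhibits it as a (5/2)⁺-power.
module Submission where

open import Defs
open import Data.List using (List; []; _∷_; _++_; length; lookup; concatMap)
open import Data.List.Properties using (length-++; ++-assoc; concatMap-++)
open import Data.Nat using (ℕ; zero; suc; _+_; _*_; _≤_; _<_; z≤n; s≤s; _≤?_; >-nonZero)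
open import Data.Nat.Properties
open import Data.Nat.Induction using (<-wellFounded)
open import Data.Nat.Tactic.RingSolver using (solve; solve-∀)
open import Data.Fin using (fromℕ<)
open import Data.Fin.Patterns using (0F; 1F; 2F)
open import Data.Product using (∃-syntax; _×_; _,_)
open import Function using (_∘_)
open import Induction.WellFounded using (Acc; acc)
open import Relation.Binary.PropositionalEquality
open import Relation.Nullary using (¬_; yes; no; contradiction)

module _ {A : Set} where

  lookup-cong : {W W′ : List A} → W ≡ W′ → {i j : ℕ} → i ≡ j →
                (h : i < length W) (h′ : j < length W′) →
                lookup W (fromℕ< h) ≡ lookup W′ (fromℕ< h′)
  lookup-cong refl refl _ _ = refl

  lookup-++ˡ : (P Q : List A) (i : ℕ) (h : i < length (P ++ Q)) (h′ : i < length P) →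
               lookup (P ++ Q) (fromℕ< h) ≡ lookup P (fromℕ< h′)
  lookup-++ˡ (a ∷ P) Q zero    _       _        = refl
  lookup-++ˡ (a ∷ P) Q (suc i) (s≤s h) (s≤s h′) = lookup-++ˡ P Q i h h′

  lookup-++ʳ : (P Q : List A) (i : ℕ) (h : length P + i < length (P ++ Q)) (h′ : i < length Q) →
               lookup (P ++ Q) (fromℕ< h) ≡ lookup Q (fromℕ< h′)
  lookup-++ʳ []      Q i h       h′ = refl
  lookup-++ʳ (a ∷ P) Q i (s≤s h) h′ = lookup-++ʳ P Q i h h′

  border⇒period : (W V U Z : List A) → W ≡ V ++ U → W ≡ U ++ Z → 1 ≤ length V →
                  IsPeriod W (length V)
  border⇒period W V U Z W≡VU W≡UZ 1≤|V| = 1≤|V| , |V|≤|W| , shift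
    where
    |W|≡|V|+|U| : length W ≡ length V + length U
    |W|≡|V|+|U| = trans (cong length W≡VU) (length-++ V)

    |V|≤|W| : length V ≤ length W
    |V|≤|W| = subst (length V ≤_) (sym |W|≡|V|+|U|) (m≤m+n _ _)

    shift : (i : ℕ) (h₁ : i < length W) (h₂ : i + length V < length W) →
            lookup W (fromℕ< h₁) ≡ lookup W (fromℕ< h₂)
    shift i h₁ h₂ = trans (lookup-in-U-prefix) (sym lookup-in-U-suffix)
      where
      |V|+i<|W| : length V + i < length W
      |V|+i<|W| = subst (_< length W) (+-comm i (length V)) h₂

      i<|U| : i < length U
      i<|U| = +-cancelˡ-< (length V) i (length U) (subst (length V + i <_) |W|≡|V|+|U| |V|+i<|W|)

      i<|UZ| : i < length (U ++ Z)
      i<|UZ| = subst (λ t → i < length t) W≡UZ h₁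

      |V|+i<|VU| : length V + i < length (V ++ U)
      |V|+i<|VU| = subst (λ t → length V + i < length t) W≡VU |V|+i<|W|

      lookup-in-U-prefix : lookup W (fromℕ< h₁) ≡ lookup U (fromℕ< i<|U|)
      lookup-in-U-prefix = trans (lookup-cong W≡UZ refl h₁ i<|UZ|) (lookup-++ˡ U Z i i<|UZ| i<|U|)

      lookup-in-U-suffix : lookup W (fromℕ< h₂) ≡ lookup U (fromℕ< i<|U|)
      lookup-in-U-suffix = trans (lookup-cong W≡VU (+-comm i (length V)) h₂ |V|+i<|VU|)
                                 (lookup-++ʳ V U i |V|+i<|VU| i<|U|)

  xyxyx-period : (X Y : List A) → 1 ≤ length (X ++ Y) →
                 IsPeriod (X ++ Y ++ X ++ Y ++ X) (length (X ++ Y))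
  xyxyx-period X Y =
    border⇒period (X ++ Y ++ X ++ Y ++ X) (X ++ Y) (X ++ Y ++ X) (Y ++ X)
      (sym (++-assoc X Y (X ++ Y ++ X)))
      (sym (trans (++-assoc X (Y ++ X) (Y ++ X)) (cong (X ++_) (++-assoc Y X (Y ++ X)))))

  length-xyxyx : (X Y : List A) →
                 length (X ++ Y ++ X ++ Y ++ X) ≡ length X + (length Y + (length X + (length Y + length X)))
  length-xyxyx X Y =
    trans (length-++ X) (cong (length X +_)
      (trans (length-++ Y) (cong (length Y +_)
        (trans (length-++ X) (cong (length X +_) (length-++ Y))))))

-- Without decidability of P the least witness exists only under ¬¬, which is enough for a goal ⊥.
¬¬-least : (P : ℕ → Set) {n : ℕ} → P n → ¬ ¬ (∃[ m ] (P m × ((q : ℕ) → P q → m ≤ q)))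
¬¬-least P {n} Pn noLeast = notBelow n (<-wellFounded n) Pn
  where
  notBelow : ∀ m → Acc _<_ m → ¬ P m
  notBelow m (acc below) Pm = noLeast (m , Pm , least)
    where
    least : ∀ q → P q → m ≤ q
    least q Pq with m ≤? q
    ... | yes m≤q = m≤q
    ... | no  m≰q = contradiction Pq (notBelow q (below (≰⇒> m≰q)))

period⇒¬¬power : {A : Set} {f : List A} {p : ℕ} →
                 IsPeriod f p → 5 * p < 2 * length f → ¬ ¬ IsPower52+ f
period⇒¬¬power {f = f} {p} per exponent>5/2 noPower =
  ¬¬-least (IsPeriod f) per λ { (m , per-m , m-least) →
    noPower (m , (per-m , m-least) , ≤-<-trans (*-monoʳ-≤ 5 (m-least p per)) exponent>5/2) }

xyxyx-exponent : {m n : ℕ} → n < m → 5 * (m + n) < 2 * (m + (n + (m + (n + m))))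
xyxyx-exponent {m} {n} n<m = +-cancelʳ-< n (5 * (m + n)) (2 * (m + (n + (m + (n + m))))) (begin-strict
  5 * (m + n) + n           <⟨ +-monoʳ-< (5 * (m + n)) n<m ⟩
  5 * (m + n) + m           ≡⟨ solve (m ∷ n ∷ []) ⟩
  2 * (m + (n + (m + (n + m)))) + n ∎)
  where open ≤-Reasoning

xyxyx-isPower : {A : Set} (X Y : List A) → length Y < length X →
                ¬ ¬ IsPower52+ (X ++ Y ++ X ++ Y ++ X)
xyxyx-isPower X Y |Y|<|X| = period⇒¬¬power {f = X ++ Y ++ X ++ Y ++ X} (xyxyx-period X Y 1≤|XY|)
  (subst₂ _<_ (cong (5 *_) (sym (length-++ X))) (cong (2 *_) (sym (length-xyxyx X Y)))
          (xyxyx-exponent |Y|<|X|))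
  where
  1≤|XY| : 1 ≤ length (X ++ Y)
  1≤|XY| = subst (1 ≤_) (sym (length-++ X)) (≤-trans (≤-<-trans z≤n |Y|<|X|) (m≤m+n _ _))

parikhWeight : (Σ₃ → ℕ) → List Σ₃ → ℕ
parikhWeight ℓ x = count 0F x * ℓ 0F + count 1F x * ℓ 1F + count 2F x * ℓ 2F

parikhWeight-∷ : ∀ ℓ a x → parikhWeight ℓ (a ∷ x) ≡ ℓ a + parikhWeight ℓ x
parikhWeight-∷ ℓ 0F x = suc-first (count 0F x) (count 1F x) (count 2F x) (ℓ 0F) (ℓ 1F) (ℓ 2F)
  where
  suc-first : ∀ a b c p q r → suc a * p + b * q + c * r ≡ p + (a * p + b * q + c * r)
  suc-first = solve-∀
parikhWeight-∷ ℓ 1F x = suc-second (count 0F x) (count 1F x) (count 2F x) (ℓ 0F) (ℓ 1F) (ℓ 2F)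
  where
  suc-second : ∀ a b c p q r → a * p + suc b * q + c * r ≡ q + (a * p + b * q + c * r)
  suc-second = solve-∀
parikhWeight-∷ ℓ 2F x = suc-third (count 0F x) (count 1F x) (count 2F x) (ℓ 0F) (ℓ 1F) (ℓ 2F)
  where
  suc-third : ∀ a b c p q r → a * p + b * q + suc c * r ≡ r + (a * p + b * q + c * r)
  suc-third = solve-∀

length-applyMorph : ∀ g x → length (applyMorph g x) ≡ parikhWeight (length ∘ g) x
length-applyMorph g []      = refl
length-applyMorph g (a ∷ x) = begin
  length (g a ++ applyMorph g x)                  ≡⟨ length-++ (g a) ⟩
  length (g a) + length (applyMorph g x)          ≡⟨ cong (length (g a) +_) (length-applyMorph g x) ⟩
  length (g a) + parikhWeight (length ∘ g) x      ≡⟨ sym (parikhWeight-∷ (length ∘ g) a x) ⟩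
  parikhWeight (length ∘ g) (a ∷ x)               ∎
  where open ≡-Reasoning

parikhWeight-monoʳ-< : ∀ {ℓ} → (∀ a → 1 ≤ ℓ a) → ∀ {x y} → ParikhGt x y →
                        parikhWeight ℓ y < parikhWeight ℓ x
parikhWeight-monoʳ-< {ℓ} ℓ-pos {x} {y} (count-≤ , a , count-<) = strict-at a count-<
  where
  term-≤ : ∀ b → count b y * ℓ b ≤ count b x * ℓ b
  term-≤ b = *-monoˡ-≤ (ℓ b) (count-≤ b)

  term-< : ∀ b → count b y < count b x → count b y * ℓ b < count b x * ℓ b
  term-< b = *-monoˡ-< (ℓ b) ⦃ >-nonZero (ℓ-pos b) ⦄

  strict-at : ∀ b → count b y < count b x → parikhWeight ℓ y < parikhWeight ℓ x
  strict-at 0F lt = +-mono-<-≤ (+-mono-<-≤ (term-< 0F lt) (term-≤ 1F)) (term-≤ 2F)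
  strict-at 1F lt = +-mono-<-≤ (+-mono-≤-< (term-≤ 0F) (term-< 1F lt)) (term-≤ 2F)
  strict-at 2F lt = +-mono-≤-< (+-mono-≤ (term-≤ 0F) (term-≤ 1F)) (term-< 2F lt)

nonErasing⇒length-applyMorph-< : ∀ {g} → NonErasing g → ∀ x y → ParikhGt x y →
                                  length (applyMorph g y) < length (applyMorph g x)
nonErasing⇒length-applyMorph-< {g} g≢[] x y π[x]>π[y] =
  subst₂ _<_ (sym (length-applyMorph g y)) (sym (length-applyMorph g x))
    (parikhWeight-monoʳ-< nonempty {x} {y} π[x]>π[y])
  where
  nonempty : ∀ a → 1 ≤ length (g a)
  nonempty a with g a | g≢[] a
  ... | []    | g[a]≢[] = contradiction refl g[a]≢[]
  ... | _ ∷ _ | _       = s≤s z≤n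

concatMap-Factor : {A B : Set} (g : A → List B) {f u : List A} →
                   Factor f u → Factor (concatMap g f) (concatMap g u)
concatMap-Factor g {f} (a , b , refl) =
  concatMap g a , concatMap g b ,
  trans (concatMap-++ g a (f ++ b)) (cong (concatMap g a ++_) (concatMap-++ g f b))

concatMap-xyxyx : {A B : Set} (g : A → List B) (x y : List A) →
                  concatMap g (x ++ y ++ x ++ y ++ x) ≡
                  let X = concatMap g x; Y = concatMap g y in X ++ Y ++ X ++ Y ++ X
concatMap-xyxyx g x y =
  trans (concatMap-++ g x _) (cong (concatMap g x ++_)
    (trans (concatMap-++ g y _) (cong (concatMap g y ++_)
      (trans (concatMap-++ g x _) (cong (concatMap g x ++_) (concatMap-++ g y x))))))

lemma5 : (u : List Σ₃) (w : List Σ₂) (g : Σ₃ → List Σ₂) →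
    NonErasing g → applyMorph g u ≡ w → Avoids52+ w →
    (x y : List Σ₃) → ParikhGt x y → ¬ Factor (x ++ y ++ x ++ y ++ x) u
lemma5 u w g g≢[] refl avoids x y π[x]>π[y] xyxyx⊑u =
  xyxyx-isPower X Y (nonErasing⇒length-applyMorph-< g≢[] x y π[x]>π[y]) (avoids _ XYXYX⊑w)
  where
  X = applyMorph g x
  Y = applyMorph g y

  XYXYX⊑w : Factor (X ++ Y ++ X ++ Y ++ X) w
  XYXYX⊑w = subst (λ f → Factor f w) (concatMap-xyxyx g x y) (concatMap-Factor g xyxyx⊑u)
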